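{- Let $q>2$ be a prime power, $n\ge2$ an integer, $F=\mathbb{F}_{q^{2n+1}}$, and let $W$, $\mathrm{PG}(W)$, $\tilde\Pi_i$ be as in the context. Let $\tilde V=\{M(a_0,a_1,0,\dots,0):a_0,a_1\in F\}$ (so $\mathrm{PG}(\tilde V)=\langle\tilde\Pi_0,\tilde\Pi_1\rangle$). Let $\omega,\alpha_2,\dots,\alpha_n\in F^*$ and let $\tilde{\mathcal{V}}_\omega$ be the image of the set of points spanned by $M(x^2,\omega x^{q+1},\alpha_2x^{q^2+1},\dots,\alpha_nx^{q^n+1})$, $x\in F^*$, under the projection from $\langle\tilde\Pi_2,\dots,\tilde\Pi_n\rangle$ onto $\mathrm{PG}(\tilde V)$ (i.e. the point spanned by $M(a_0,\dots,a_n)$ is mapped to the point spanned by $M(a_0,a_1,0,\dots,0)$). Let $\mathrm{PG}(4n+1,q)$ be the projective space whose points are the $1$-dimensional $\mathbb{F}_q$-subspaces of $F\times F$, and $\mathcal{V}_\omega$ the set of its points spanned by $(x^2,\omega x^{q+1})$, $x\in F^*$. Then $\tilde{\mathcal{V}}_\omega$ and $\mathcal{V}_\omega$ are projectively equivalent.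
   Context: For $a_0,\dots,a_n\in F$, $M(a_0,\dots,a_n)=(m_{ij})_{0\le i,j\le 2n}$ is the symmetric $(2n+1)\times(2n+1)$ matrix over $F$ with, for $0\le i\le j\le 2n$ and $d=j-i$: $m_{ij}=a_d^{q^i}$ if $d\le n$, and $m_{ij}=a_{2n+1-d}^{q^j}$ if $d>n$; and $m_{ji}=m_{ij}$. $W=\{M(a_0,\dots,a_n):a_i\in F\}$ is an $\mathbb{F}_q$-vector space of dimension $(n+1)(2n+1)$, and $\mathrm{PG}(W)$ is its projective space. $\tilde\Pi_i$ is the subspace of points spanned by $M(0,\dots,0,a_i,0,\dots,0)$, $a_i\in F^*$. -}

module Defs where

open import Level using (0ℓ)
open import Algebra.Bundles using (CommutativeRing)
open import Data.Nat as ℕ using (ℕ; zero; suc; _≤_; _<_; _<?_; _≤?_; _∸_)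
open import Data.Nat.Primality using (Prime)
open import Data.Fin using (Fin; toℕ; fromℕ<)
open import Data.Product using (Σ; ∃; _×_; _,_)
open import Relation.Nullary using (¬_; yes; no)
open import Function.Bundles using (Bijection; _⇔_)
open import Relation.Binary.PropositionalEquality as ≡ using (_≡_)

IsPrimePower : ℕ → Set
IsPrimePower q = Σ ℕ λ p → Σ ℕ λ k → Prime p × 1 ≤ k × q ≡ p ℕ.^ k

record Field : Set₁ where
  field
    commRing : CommutativeRing 0ℓ 0ℓ
  open CommutativeRing commRing public
  field
    0≉1     : ¬ (0# ≈ 1#)
    inverse : ∀ x → ¬ (x ≈ 0#) → Σ Carrier λ y → x * y ≈ 1#

module _ (F : Field) where
  open Field F

  pow : Carrier → ℕ → Carrier
  pow x zero    = 1#
  pow x (suc k) = x * pow x k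

  HasCard : ℕ → Set
  HasCard N = Bijection setoid (≡.setoid (Fin N))

  InFq : ℕ → Carrier → Set
  InFq q x = pow x q ≈ x

  NonZero : Carrier → Set
  NonZero x = ¬ (x ≈ 0#)

  record Mat (n : ℕ) : Set where
    constructor mat
    field
      entry : Fin (suc (2 ℕ.* n)) → Fin (suc (2 ℕ.* n)) → Carrier
  open Mat public

  _≈M_ : ∀ {n} → Mat n → Mat n → Set
  A ≈M B = ∀ i j → entry A i j ≈ entry B i j

  _+M_ : ∀ {n} → Mat n → Mat n → Mat n
  A +M B = mat λ i j → entry A i j + entry B i j

  _·M_ : ∀ {n} → Carrier → Mat n → Mat n
  c ·M A = mat λ i j → c * entry A i j

  0M : ∀ {n} → Mat n
  0M = mat λ i j → 0#

  -- a_d for d : ℕ, where a = (a_0,…,a_n) (out-of-range indices never occur below)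
  coef : ∀ {n} → (Fin (suc n) → Carrier) → ℕ → Carrier
  coef {n} a d with d <? suc n
  ... | yes d<n = a (fromℕ< d<n)
  ... | no _    = 0#

  entry≤ : ∀ {n} → ℕ → (Fin (suc n) → Carrier) → ℕ → ℕ → Carrier
  entry≤ {n} q a i j with (j ∸ i) ≤? n
  ... | yes _ = pow (coef a (j ∸ i)) (q ℕ.^ i)
  ... | no _  = pow (coef a (suc (2 ℕ.* n) ∸ (j ∸ i))) (q ℕ.^ j)

  Mentry : ∀ {n} → ℕ → (Fin (suc n) → Carrier) → ℕ → ℕ → Carrier
  Mentry q a i j with i ≤? j
  ... | yes _ = entry≤ q a i j
  ... | no _  = entry≤ q a j i

  M : ∀ {n} → ℕ → (Fin (suc n) → Carrier) → Mat n
  M q a = mat λ i j → Mentry q a (toℕ i) (toℕ j)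

  proj01 : ∀ {n} → (Fin (suc n) → Carrier) → Fin (suc n) → Carrier
  proj01 a i with toℕ i ≤? 1
  ... | yes _ = a i
  ... | no _  = 0#

  -- coefficient vector (x^2, ω x^(q+1), α_2 x^(q^2+1), …, α_n x^(q^n+1))
  -- (α is indexed by Fin (suc n); only α_i with i ≥ 2 are used)
  genCoef : ∀ {n} → ℕ → Carrier → (Fin (suc n) → Carrier) → Carrier → Fin (suc n) → Carrier
  genCoef q ω α x i with toℕ i
  ... | zero        = pow x 2
  ... | suc zero    = ω * pow x (q ℕ.+ 1)
  ... | suc (suc k) = α i * pow x (q ℕ.^ suc (suc k) ℕ.+ 1)

  InṼ : ∀ {n} → ℕ → Mat n → Set
  InṼ {n} q A = Σ Carrier λ a₀ → Σ Carrier λ a₁ →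
    A ≈M M q (proj01 {n} (λ i → coef′ a₀ a₁ (toℕ i)))
    where
    coef′ : Carrier → Carrier → ℕ → Carrier
    coef′ a₀ a₁ zero = a₀
    coef′ a₀ a₁ (suc zero) = a₁
    coef′ a₀ a₁ (suc (suc _)) = 0#

  -- the point set Ṽ_ω: a nonzero vector v of Ṽ spans a point of Ṽ_ω iff
  -- v = λ · M(proj01 (genCoef x)) for some x ∈ F* and λ ∈ F_q*
  InṼω : ∀ {n} → ℕ → Carrier → (Fin (suc n) → Carrier) → Mat n → Set
  InṼω q ω α A = Σ Carrier λ x → NonZero x × Σ Carrier λ l → InFq q l × NonZero l ×
    A ≈M (l ·M M q (proj01 (genCoef q ω α x)))

  _≈₂_ : Carrier × Carrier → Carrier × Carrier → Set
  (a , b) ≈₂ (c , d) = (a ≈ c) × (b ≈ d)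

  InVω : ℕ → Carrier → Carrier × Carrier → Set
  InVω q ω u = Σ Carrier λ x → NonZero x × Σ Carrier λ l → InFq q l × NonZero l ×
    u ≈₂ (l * pow x 2 , l * (ω * pow x (q ℕ.+ 1)))

  _+₂_ : Carrier × Carrier → Carrier × Carrier → Carrier × Carrier
  (a , b) +₂ (c , d) = (a + c , b + d)

  _·₂_ : Carrier → Carrier × Carrier → Carrier × Carrier
  l ·₂ (a , b) = (l * a , l * b)

  IsFqAut : ℕ → (Carrier → Carrier) → Set
  IsFqAut q σ =
    (∀ l m → l ≈ m → σ l ≈ σ m) ×
    (∀ l → InFq q l → InFq q (σ l)) ×
    (∀ l m → InFq q l → InFq q m → σ (l + m) ≈ σ l + σ m) ×
    (∀ l m → InFq q l → InFq q m → σ (l * m) ≈ σ l * σ m) ×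
    (∀ l m → InFq q l → InFq q m → σ l ≈ σ m → l ≈ m) ×
    (∀ m → InFq q m → Σ Carrier λ l → InFq q l × σ l ≈ m)

  -- Projective equivalence of Ṽ_ω ⊆ PG(Ṽ) and V_ω ⊆ PG(F×F) (both over F_q):
  -- a σ-semilinear bijection φ : Ṽ → F×F such that a nonzero v ∈ Ṽ spans a
  -- point of Ṽ_ω iff φ v spans a point of V_ω (i.e. the induced collineation
  -- maps Ṽ_ω onto V_ω).  φ is given on all matrices, but only its behaviour
  -- on Ṽ matters.
  ProjEquiv : (n q : ℕ) → Carrier → (Fin (suc n) → Carrier) → Set
  ProjEquiv n q ω α =
    Σ (Carrier → Carrier) λ σ → IsFqAut q σ ×
    Σ (Mat n → Carrier × Carrier) λ φ →
      (∀ u v → InṼ q u → InṼ q v → u ≈M v → φ u ≈₂ φ v) ×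
      (∀ u v → InṼ q u → InṼ q v → φ (u +M v) ≈₂ (φ u +₂ φ v)) ×
      (∀ l u → InFq q l → InṼ q u → φ (l ·M u) ≈₂ (σ l ·₂ φ u)) ×
      (∀ u v → InṼ q u → InṼ q v → φ u ≈₂ φ v → u ≈M v) ×
      (∀ w → Σ (Mat n) λ u → InṼ q u × φ u ≈₂ w) ×
      (∀ u → InṼ q u → ¬ (u ≈M 0M) →
         (InṼω q ω α u → InVω q ω (φ u)) × (InVω q ω (φ u) → InṼω q ω α u))

{-# OPTIONS --safe #-}
-- Reading off the entries m₀₀ = a₀ and m₀₁ = a₁ of M(a₀,a₁,0,…,0) is an F_q-linear
-- bijection Ṽ → F × F.  Since the Frobenius powers x ↦ x^(q^i) fix F_q, M is F_q-linear
-- in its coefficient vector, so λ·M(x², ωx^(q+1), 0,…,0) is sent to λ·(x², ωx^(q+1)).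
module Submission where

open import Defs
open import Data.Nat using (ℕ; suc; _≤_; _<_; _^_; _+_; _*_)
open import Data.Fin using (Fin; toℕ)
open import Relation.Nullary using (¬_)

import Data.Nat as ℕ
import Data.Fin as Fin
open import Data.Nat using (zero; s≤s)
open import Data.Product using (Σ; _,_; _×_; proj₁; proj₂)
open import Data.Product.Relation.Binary.Pointwise.NonDependent using (×-setoid)
open import Relation.Binary.Bundles using (Setoid)
open import Data.Vec.Functional using (_∷_)
open import Function using (id)
open import Relation.Nullary using (yes; no)
import Relation.Binary.PropositionalEquality as ≡

module FrobeniusPowers (F : Field) where
  open Field F renaming (_*_ to _·_)
  open import Algebra.Properties.CommutativeSemiring.Exp commutativeSemiring
    using (^-congˡ; ^-assocʳ; ^-distrib-*) renaming (_^_ to _^ᶠ_)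
  open import Relation.Binary.Reasoning.Setoid setoid

  pow≡^ : ∀ x k → pow F x k ≡.≡ x ^ᶠ k
  pow≡^ x zero    = ≡.refl
  pow≡^ x (suc k) = ≡.cong (x ·_) (pow≡^ x k)

  pow-congˡ : ∀ k {x y} → x ≈ y → pow F x k ≈ pow F y k
  pow-congˡ k {x} {y} x≈y rewrite pow≡^ x k | pow≡^ y k = ^-congˡ k x≈y

  pow-distrib-* : ∀ x y k → pow F (x · y) k ≈ pow F x k · pow F y k
  pow-distrib-* x y k rewrite pow≡^ (x · y) k | pow≡^ x k | pow≡^ y k = ^-distrib-* x y k

  pow-assocʳ : ∀ x m k → pow F (pow F x m) k ≈ pow F x (m * k)
  pow-assocʳ x m k rewrite pow≡^ (pow F x m) k | pow≡^ x m | pow≡^ x (m * k) =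
    ^-assocʳ x m k

  InFq-1# : ∀ q → InFq F q 1#
  InFq-1# zero    = refl
  InFq-1# (suc q) = trans (*-identityˡ _) (InFq-1# q)

  InFq⇒pow-q^-fixed : ∀ q {l} → InFq F q l → ∀ i → pow F l (q ^ i) ≈ l
  InFq⇒pow-q^-fixed q {l} l∈Fq zero    = *-identityʳ l
  InFq⇒pow-q^-fixed q {l} l∈Fq (suc i) = begin
    pow F l (q * q ^ i)        ≈⟨ pow-assocʳ l q (q ^ i) ⟨
    pow F (pow F l q) (q ^ i)  ≈⟨ pow-congˡ (q ^ i) l∈Fq ⟩
    pow F l (q ^ i)            ≈⟨ InFq⇒pow-q^-fixed q l∈Fq i ⟩
    l                          ∎

  pow-q^-homogeneous : ∀ q {l} → InFq F q l → ∀ b i →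
                       pow F (l · b) (q ^ i) ≈ l · pow F b (q ^ i)
  pow-q^-homogeneous q {l} l∈Fq b i =
    trans (pow-distrib-* l b (q ^ i)) (*-congʳ (InFq⇒pow-q^-fixed q l∈Fq i))

module _ (F : Field) where
  open Field F renaming (_*_ to _·_)

  id-IsFqAut : ∀ q → IsFqAut F q id
  id-IsFqAut q = (λ _ _ → id) , (λ _ → id) , (λ _ _ _ _ → refl) , (λ _ _ _ _ → refl) ,
                 (λ _ _ _ _ → id) , (λ m m∈Fq → m , m∈Fq , refl)

  proj01-scale : ∀ {n} {a b : Fin (suc n) → Carrier} l →
                 (∀ k → toℕ k ≤ 1 → a k ≈ l · b k) →
                 ∀ k → proj01 F a k ≈ l · proj01 F b k
  proj01-scale l a≈lb k with toℕ k ℕ.≤? 1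
  ... | yes k≤1 = a≈lb k k≤1
  ... | no _    = sym (zeroʳ l)

  leadingEntries : ∀ {m} → Mat F (suc m) → Carrier × Carrier
  leadingEntries u = entry u Fin.zero Fin.zero , entry u Fin.zero (Fin.suc Fin.zero)

  leadingEntries-cong : ∀ {m} {u v : Mat F (suc m)} → _≈M_ F u v →
                        _≈₂_ F (leadingEntries u) (leadingEntries v)
  leadingEntries-cong u≈v = u≈v Fin.zero Fin.zero , u≈v Fin.zero (Fin.suc Fin.zero)

module CoefficientMatrix (F : Field) (q : ℕ) where
  open Field F hiding (_+_) renaming (_*_ to _·_)
  open FrobeniusPowers F

  module _ {n} {a b : Fin (suc n) → Carrier} {l} (l∈Fq : InFq F q l)
           (a≈lb : ∀ k → a k ≈ l · b k) where

    coef-scale : ∀ d → coef F a d ≈ l · coef F b d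
    coef-scale d with d ℕ.<? suc n
    ... | yes _ = a≈lb _
    ... | no _  = sym (zeroʳ l)

    entry≤-scale : ∀ i j → entry≤ F q a i j ≈ l · entry≤ F q b i j
    entry≤-scale i j with (j ℕ.∸ i) ℕ.≤? n
    ... | yes _ = trans (pow-congˡ (q ^ i) (coef-scale (j ℕ.∸ i)))
                        (pow-q^-homogeneous q l∈Fq _ i)
    ... | no _  = trans (pow-congˡ (q ^ j) (coef-scale (suc (2 * n) ℕ.∸ (j ℕ.∸ i))))
                        (pow-q^-homogeneous q l∈Fq _ j)

    Mentry-scale : ∀ i j → Mentry F q a i j ≈ l · Mentry F q b i j
    Mentry-scale i j with i ℕ.≤? j
    ... | yes _ = entry≤-scale i j
    ... | no _  = entry≤-scale j i

    M-scale : _≈M_ F (M F q a) (_·M_ F l (M F q b))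
    M-scale i j = Mentry-scale (toℕ i) (toℕ j)

  M-homogeneous : ∀ {n} {b : Fin (suc n) → Carrier} {l} → InFq F q l →
                  _≈M_ F (M F q (λ k → l · b k)) (_·M_ F l (M F q b))
  M-homogeneous l∈Fq = M-scale l∈Fq (λ _ → refl)

  module _ {m} {c d : Fin (suc (suc m)) → Carrier} where

    M-proj01-scale : ∀ {l} → InFq F q l →
                     c Fin.zero ≈ l · d Fin.zero →
                     c (Fin.suc Fin.zero) ≈ l · d (Fin.suc Fin.zero) →
                     _≈M_ F (M F q (proj01 F c)) (_·M_ F l (M F q (proj01 F d)))
    M-proj01-scale {l} l∈Fq c₀≈ld₀ c₁≈ld₁ = M-scale l∈Fq (proj01-scale F l c≈ld)
      where
      c≈ld : ∀ k → toℕ k ≤ 1 → c k ≈ l · d k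
      c≈ld Fin.zero              _        = c₀≈ld₀
      c≈ld (Fin.suc Fin.zero)    _        = c₁≈ld₁
      c≈ld (Fin.suc (Fin.suc _)) (s≤s ())

    M-proj01-cong : c Fin.zero ≈ d Fin.zero →
                    c (Fin.suc Fin.zero) ≈ d (Fin.suc Fin.zero) →
                    _≈M_ F (M F q (proj01 F c)) (M F q (proj01 F d))
    M-proj01-cong c₀≈d₀ c₁≈d₁ i j =
      trans (M-proj01-scale (InFq-1# q) (by-1· c₀≈d₀) (by-1· c₁≈d₁) i j) (*-identityˡ _)
      where
      by-1· : ∀ {x y} → x ≈ y → x ≈ 1# · y
      by-1· x≈y = trans x≈y (sym (*-identityˡ _))

  ≈M-M⇒leadingEntries : ∀ {m} {u : Mat F (suc m)} {a} → _≈M_ F u (M F q a) →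
                        _≈₂_ F (leadingEntries F u) (a Fin.zero , a (Fin.suc Fin.zero))
  ≈M-M⇒leadingEntries u≈Ma = trans (u≈Ma Fin.zero Fin.zero) (*-identityʳ _) ,
                            trans (u≈Ma Fin.zero (Fin.suc Fin.zero)) (*-identityʳ _)

  module ≈₂ = Setoid (×-setoid setoid setoid)

  leadingEntries-injective-on-Ṽ : ∀ {m} {u v : Mat F (suc m)} → InṼ F q u → InṼ F q v →
    _≈₂_ F (leadingEntries F u) (leadingEntries F v) → _≈M_ F u v
  leadingEntries-injective-on-Ṽ (a₀ , a₁ , u≈) (b₀ , b₁ , v≈) u₀₁≈v₀₁ i j =
    trans (u≈ i j) (trans (M-proj01-cong (proj₁ a≈b) (proj₂ a≈b) i j) (sym (v≈ i j)))
    where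
    a≈b : _≈₂_ F (a₀ , a₁) (b₀ , b₁)
    a≈b = ≈₂.trans (≈₂.sym (≈M-M⇒leadingEntries u≈))
                   (≈₂.trans u₀₁≈v₀₁ (≈M-M⇒leadingEntries v≈))

  leadingEntries-surjective-on-Ṽ : ∀ {m} w →
    Σ (Mat F (suc m)) λ u → InṼ F q u × _≈₂_ F (leadingEntries F u) w
  leadingEntries-surjective-on-Ṽ {m} (w₀ , w₁) =
    M F q (proj01 F c) , (w₀ , w₁ , M-proj01-cong refl refl) ,
    ≈M-M⇒leadingEntries {a = proj01 F c} (λ _ _ → refl)
    where
    c : Fin (suc (suc m)) → Carrier
    c = w₀ ∷ w₁ ∷ λ _ → 0#

  module _ {m} {ω : Carrier} {α : Fin (suc (suc m)) → Carrier} {u : Mat F (suc m)} where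

    InṼω⇒InVω : InṼω F q ω α u → InVω F q ω (leadingEntries F u)
    InṼω⇒InVω (x , x≉0 , l , l∈Fq , l≉0 , u≈lMg) =
      x , x≉0 , l , l∈Fq , l≉0 ,
      ≈M-M⇒leadingEntries (λ i j → trans (u≈lMg i j) (sym (M-homogeneous {b = g} l∈Fq i j)))
      where
      g : Fin (suc (suc m)) → Carrier
      g = proj01 F (genCoef F q ω α x)

    InṼ⇒InVω⇒InṼω : InṼ F q u → InVω F q ω (leadingEntries F u) → InṼω F q ω α u
    InṼ⇒InVω⇒InṼω (a₀ , a₁ , u≈) (x , x≉0 , l , l∈Fq , l≉0 , u₀₁≈lg₀₁) =
      x , x≉0 , l , l∈Fq , l≉0 ,
      λ i j → trans (u≈ i j) (M-proj01-scale l∈Fq (proj₁ a≈lg) (proj₂ a≈lg) i j)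
      where
      a≈lg : _≈₂_ F (a₀ , a₁) (l · pow F x 2 , l · (ω · pow F x (q + 1)))
      a≈lg = ≈₂.trans (≈₂.sym (≈M-M⇒leadingEntries u≈)) u₀₁≈lg₀₁

proposition4p4 : (q n : ℕ) → IsPrimePower q → 2 < q → 2 ≤ n →
    (F : Field) → HasCard F (q ^ (1 + 2 * n)) →
    (ω : Field.Carrier F) → NonZero F ω →
    (α : Fin (suc n) → Field.Carrier F) → (∀ i → 2 ≤ toℕ i → NonZero F (α i)) →
    ProjEquiv F n q ω α
proposition4p4 q zero    _ _ () _ _ _ _ _ _
proposition4p4 q (suc m) _ _ _  F _ ω _ α _ =
  id , id-IsFqAut F q , leadingEntries F ,
  (λ _ _ _ _ → leadingEntries-cong F) ,
  (λ _ _ _ _ → refl , refl) ,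
  (λ _ _ _ _ → refl , refl) ,
  (λ _ _ → leadingEntries-injective-on-Ṽ) ,
  leadingEntries-surjective-on-Ṽ ,
  (λ _ u∈Ṽ _ → InṼω⇒InVω , InṼ⇒InVω⇒InṼω u∈Ṽ)
  where
  open Field F using (refl)
  open CoefficientMatrix F q
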